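{- For every integer $n\ge 1$, $N'(n,0,n-1)=n-1$.
   Context: $\mathbb{Z}_4$ is the ring of integers modulo $4$; a $\mathbb{Z}_4$-code of length $n$ is a $\mathbb{Z}_4$-submodule of $\mathbb{Z}_4^n$. A code has type $4^{k_1}2^{k_2}$ if it is isomorphic as an abelian group to $\mathbb{Z}_4^{k_1}\times\mathbb{Z}_2^{k_2}$. Two codes of the same length are equivalent if one is obtained from the other by permuting coordinates and changing signs of some coordinates. The trivial extension of a code $C$ of length $n-1$ is $\{(c,0)\mid c\in C\}$ (for $n-1=0$, the only code is the zero module). $N'(n,k_1,k_2)$ denotes the number of equivalence classes of $\mathbb{Z}_4$-codes of length $n$ and type $4^{k_1}2^{k_2}$ none of whose members is equivalent to the trivial extension of a $\mathbb{Z}_4$-code of length $n-1$. -}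

module Defs where

open import Data.Nat using (ℕ; zero; suc; _+_; _*_)
open import Data.Nat.DivMod using (_mod_)
open import Data.Fin using (Fin; toℕ) renaming (zero to fzero; suc to fsuc)
open import Data.Empty using (⊥)
open import Data.Fin.Permutation using (Permutation′; _⟨$⟩ʳ_)
open import Data.Bool using (Bool; true; false; _∧_)
open import Data.Vec using (Vec; []; _∷_; lookup; tabulate; zipWith; map; replicate; last; init)
open import Data.Product using (Σ; _×_; _,_; ∃; ∃-syntax)
open import Relation.Nullary using (¬_)
open import Relation.Binary.PropositionalEquality using (_≡_)

ℤ₄ : Set
ℤ₄ = Fin 4

ℤ₂ : Set
ℤ₂ = Fin 2

_+₄_ : ℤ₄ → ℤ₄ → ℤ₄
a +₄ b = (toℕ a + toℕ b) mod 4

_*₄_ : ℤ₄ → ℤ₄ → ℤ₄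
a *₄ b = (toℕ a * toℕ b) mod 4

-₄_ : ℤ₄ → ℤ₄
-₄ a = (3 * toℕ a) mod 4

_+₂_ : ℤ₂ → ℤ₂ → ℤ₂
a +₂ b = (toℕ a + toℕ b) mod 2

Word : ℕ → Set
Word n = Vec ℤ₄ n

_⊕_ : ∀ {n} → Word n → Word n → Word n
_⊕_ = zipWith _+₄_

_·_ : ∀ {n} → ℤ₄ → Word n → Word n
a · v = map (a *₄_) v

0w : ∀ {n} → Word n
0w = replicate _ fzero

Subset4 : ℕ → Set
Subset4 n = Word n → Bool

_∈C_ : ∀ {n} → Word n → Subset4 n → Set
v ∈C C = C v ≡ true

record Code (n : ℕ) : Set where
  field
    mem    : Subset4 n
    zero∈  : 0w ∈C mem
    add∈   : ∀ u v → u ∈C mem → v ∈C mem → (u ⊕ v) ∈C mem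
    smul∈  : ∀ a v → v ∈C mem → (a · v) ∈C mem
open Code public

-- C is isomorphic as an abelian group to ℤ₄^k₁ × ℤ₂^k₂:
-- an injective additive map from ℤ₄^k₁ × ℤ₂^k₂ into ℤ₄ⁿ with image exactly C
HasType : ∀ {n} → Code n → ℕ → ℕ → Set
HasType {n} C k₁ k₂ =
  Σ (Vec ℤ₄ k₁ × Vec ℤ₂ k₂ → Word n) λ φ →
    (∀ a b a' b' → φ (zipWith _+₄_ a a' , zipWith _+₂_ b b') ≡ (φ (a , b) ⊕ φ (a' , b')))
  × (∀ x y → φ x ≡ φ y → x ≡ y)
  × (∀ v → v ∈C mem C → ∃[ x ] φ x ≡ v)
  × (∀ x → φ x ∈C mem C)

-- sign change (true = negate) followed by coordinate permutation
signed : Bool → ℤ₄ → ℤ₄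
signed true  a = -₄ a
signed false a = a

act : ∀ {n} → Permutation′ n → (Fin n → Bool) → Word n → Word n
act σ s v = tabulate λ i → signed (s i) (lookup v (σ ⟨$⟩ʳ i))

EquivS : ∀ {n} → Subset4 n → Subset4 n → Set
EquivS {n} C D = Σ (Permutation′ n) λ σ → Σ (Fin n → Bool) λ s →
  (∀ c → c ∈C C → act σ s c ∈C D) × (∀ d → d ∈C D → ∃[ c ] (c ∈C C × act σ s c ≡ d))

Equiv : ∀ {n} → Code n → Code n → Set
Equiv C D = EquivS (mem C) (mem D)

trivExt : ∀ {m} → Subset4 m → Subset4 (suc m)
trivExt C v = isZero (last v) ∧ C (init v)
  where
    isZero : ℤ₄ → Bool
    isZero fzero = true
    isZero (fsuc _) = false

-- C (of length m+1) is counted by N': right type and not equivalent to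
-- the trivial extension of any code of length m
Counted : ∀ {m} → Code (suc m) → ℕ → ℕ → Set
Counted {m} C k₁ k₂ = HasType C k₁ k₂ × (∀ (C' : Code m) → ¬ EquivS (mem C) (trivExt (mem C')))

-- N'(m+1, k₁, k₂) = c : there is a complete system of c pairwise
-- inequivalent representatives of the equivalence classes of counted codes
N′≡ : ℕ → ℕ → ℕ → ℕ → Set
N′≡ zero    k₁ k₂ c = ⊥
N′≡ (suc m) k₁ k₂ c =
  Σ (Vec (Code (suc m)) c) λ R →
    (∀ i → Counted (lookup R i) k₁ k₂)
  × (∀ i j → Equiv (lookup R i) (lookup R j) → i ≡ j)
  × (∀ (C : Code (suc m)) → Counted C k₁ k₂ → ∃[ i ] Equiv C (lookup R i))

module Submission where

-- A code C of type 2^m is an elementary abelian 2-group, so all its words are even and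
-- C = 2H for a subset H of 𝔽₂^(m+1) that is closed under addition and in bijection with
-- 𝔽₂^m.  By counting, such an H is a hyperplane, so C = K(w) = { 2h | dot w h = 0 } for a
-- nonzero w.  Sign changes fix even words, hence K(w) and K(w') are equivalent exactly
-- when w' is a coordinate permutation of w, i.e. when wt w = wt w'.  Weight 1 gives a
-- trivial extension; for weight at least 2 every coordinate carries the entry 2 in some
-- codeword, which rules out trivial extensions.  So the classes counted by N′ are
-- represented by K(1^(j+2) 0^(m-j-1)) for j < m, one for each j.

open import Defs
open import Algebra.Bundles using (CommutativeRing)
import Algebra.Properties.CommutativeMonoid.Sum as CommutativeMonoidSum
open import Data.Bool using (Bool; true; false; _∧_; not; _xor_)
open import Data.Bool.Properties
  using (∧-assoc; ∧-comm; ∧-identityʳ; ∧-zeroʳ; ∧-distribˡ-xor; not-involutive;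
         xor-same; xor-comm; xor-assoc; xor-identityˡ; xor-identityʳ; xor-∧-commutativeRing)
open import Data.Empty using (⊥-elim)
open import Data.Fin using (Fin; toℕ; fromℕ; fromℕ<; punchOut) renaming (zero to fzero; suc to fsuc)
open import Data.Fin.Permutation using (Permutation′; _⟨$⟩ʳ_; inverseʳ; flip; _∘ₚ_; lift₀; permutation)
import Data.Fin.Permutation as Perm
import Data.Fin.Properties as Finₚ
open import Data.Nat using (ℕ; zero; suc; _+_; _^_; _≤_; _<_; _<ᵇ_; z≤n; s≤s)
import Data.Nat.Properties as ℕₚ
open import Data.Product using (Σ; _×_; _,_; ∃-syntax; proj₁; proj₂)
open import Data.Sum using (_⊎_; inj₁; inj₂)
open import Data.Vec using (Vec; []; _∷_; tail; lookup; tabulate; zipWith; map; replicate; last; init)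
open import Data.Vec.Properties
  using (lookup∘tabulate; tabulate∘lookup; tabulate-cong; lookup-map; lookup-zipWith;
         tabulate-∘; zipWith-comm; zipWith-assoc; zipWith-identityˡ; zipWith-identityʳ; map-const)
open import Data.Vec.Recursive using (lift↔; Fin[m^n]↔Fin[m]^n)
open import Data.Vec.Recursive.Properties using (↔Vec)
open import Function using (_∘_; _↔_; Inverse; Injection)
open import Function.Definitions using (Injective)
open import Function.Properties.Inverse using (↔-trans; ↔-sym; ↔⇒↣)
open import Relation.Nullary using (¬_; yes; no)
open import Relation.Binary.PropositionalEquality
  using (_≡_; _≢_; refl; sym; trans; cong; cong₂; subst; subst₂; module ≡-Reasoning)

-- Binary vectors: Bool with xor and ∧ is the field 𝔽₂, and Bits n is 𝔽₂ⁿ.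

Bits : ℕ → Set
Bits n = Vec Bool n

zeros : ∀ n → Bits n
zeros n = replicate n false

infixl 6 _⊻_
_⊻_ : ∀ {n} → Bits n → Bits n → Bits n
_⊻_ = zipWith _xor_

module XorSum = CommutativeMonoidSum (CommutativeRing.+-commutativeMonoid xor-∧-commutativeRing)
module NatSum = CommutativeMonoidSum ℕₚ.+-0-commutativeMonoid

-- The standard bilinear form on 𝔽₂ⁿ; on a cons it unfolds to (a ∧ b) xor dot w v.
dot : ∀ {n} → Bits n → Bits n → Bool
dot w v = XorSum.sum (λ i → lookup w i ∧ lookup v i)

-- Hamming weight; on a cons it unfolds to weight of the head plus wt of the tail.
bitValue : Bool → ℕ
bitValue false = 0
bitValue true  = 1

wt : ∀ {n} → Bits n → ℕ
wt w = NatSum.sum (λ i → bitValue (lookup w i))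

unit : ∀ {n} → Fin n → Bits n
unit {suc n} fzero    = true ∷ zeros n
unit {suc n} (fsuc i) = false ∷ unit i

≡-by-lookup : ∀ {A : Set} {n} (u v : Vec A n) → (∀ i → lookup u i ≡ lookup v i) → u ≡ v
≡-by-lookup u v p = trans (sym (tabulate∘lookup u)) (trans (tabulate-cong p) (tabulate∘lookup v))

⊻-comm : ∀ {n} (u v : Bits n) → u ⊻ v ≡ v ⊻ u
⊻-comm = zipWith-comm xor-comm

⊻-identityʳ : ∀ {n} (u : Bits n) → u ⊻ zeros n ≡ u
⊻-identityʳ = zipWith-identityʳ xor-identityʳ

⊻-self : ∀ {n} (u : Bits n) → u ⊻ u ≡ zeros n
⊻-self []      = refl
⊻-self (a ∷ u) = cong₂ _∷_ (xor-same a) (⊻-self u)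

⊻-cancelˡ : ∀ {n} (u v : Bits n) → u ⊻ (u ⊻ v) ≡ v
⊻-cancelˡ {n} u v = begin
  u ⊻ (u ⊻ v)   ≡⟨ sym (zipWith-assoc xor-assoc u u v) ⟩
  (u ⊻ u) ⊻ v   ≡⟨ cong (_⊻ v) (⊻-self u) ⟩
  zeros n ⊻ v   ≡⟨ zipWith-identityˡ xor-identityˡ v ⟩
  v             ∎
  where open ≡-Reasoning

dot-zerosʳ : ∀ {n} (w : Bits n) → dot w (zeros n) ≡ false
dot-zerosʳ []      = refl
dot-zerosʳ (a ∷ w) rewrite ∧-zeroʳ a = dot-zerosʳ w

dot-⊻ʳ : ∀ {n} (w u v : Bits n) → dot w (u ⊻ v) ≡ dot w u xor dot w v
dot-⊻ʳ w u v = begin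
  XorSum.sum (λ i → lookup w i ∧ lookup (u ⊻ v) i)
    ≡⟨ XorSum.sum-cong-≗ (λ i → trans (cong (lookup w i ∧_) (lookup-zipWith _xor_ i u v))
                                      (∧-distribˡ-xor (lookup w i) (lookup u i) (lookup v i))) ⟩
  XorSum.sum (λ i → (lookup w i ∧ lookup u i) xor (lookup w i ∧ lookup v i))
    ≡⟨ XorSum.∑-distrib-+ (λ i → lookup w i ∧ lookup u i) (λ i → lookup w i ∧ lookup v i) ⟩
  dot w u xor dot w v ∎
  where open ≡-Reasoning

dot-scaleʳ : ∀ {n} (c : Bool) (w u : Bits n) → dot w (map (c ∧_) u) ≡ c ∧ dot w u
dot-scaleʳ false w u = trans (cong (dot w) (map-const u false)) (dot-zerosʳ w)
dot-scaleʳ true  w u = cong (dot w) (map-true u)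
  where
  map-true : ∀ {n} (u : Bits n) → map (true ∧_) u ≡ u
  map-true []      = refl
  map-true (b ∷ u) = cong (b ∷_) (map-true u)

dot-unitʳ : ∀ {n} (w : Bits n) (i : Fin n) → dot w (unit i) ≡ lookup w i
dot-unitʳ (a ∷ w) fzero    rewrite ∧-identityʳ a | dot-zerosʳ w = xor-identityʳ a
dot-unitʳ (a ∷ w) (fsuc i) rewrite ∧-zeroʳ a = dot-unitʳ w i

dot-separates : ∀ {n} (w w' : Bits n) → (∀ v → dot w v ≡ dot w' v) → w ≡ w'
dot-separates w w' p = ≡-by-lookup w w' λ i →
  trans (sym (dot-unitʳ w i)) (trans (p (unit i)) (dot-unitʳ w' i))

linear⇒dot : ∀ {n} (χ : Bits n → Bool) → (∀ u v → χ (u ⊻ v) ≡ χ u xor χ v) →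
             ∀ v → χ v ≡ dot (tabulate (χ ∘ unit)) v
linear⇒dot {zero}  χ lin [] = trans (lin [] []) (xor-same (χ []))
linear⇒dot {suc n} χ lin (a ∷ v) = begin
  χ (a ∷ v)                          ≡⟨ cong χ (sym split) ⟩
  χ ((a ∷ zeros n) ⊻ (false ∷ v))    ≡⟨ lin (a ∷ zeros n) (false ∷ v) ⟩
  χ (a ∷ zeros n) xor χ (false ∷ v)  ≡⟨ cong₂ _xor_ (head a) (linear⇒dot χ′ lin′ v) ⟩
  dot (tabulate (χ ∘ unit)) (a ∷ v)  ∎
  where
  open ≡-Reasoning
  χ′ : Bits n → Bool
  χ′ u = χ (false ∷ u)
  lin′ : ∀ u u' → χ′ (u ⊻ u') ≡ χ′ u xor χ′ u'
  lin′ u u' = lin (false ∷ u) (false ∷ u')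
  split : (a ∷ zeros n) ⊻ (false ∷ v) ≡ a ∷ v
  split = cong₂ _∷_ (xor-identityʳ a) (trans (⊻-comm (zeros n) v) (⊻-identityʳ v))
  χ-zero : χ (zeros (suc n)) ≡ false
  χ-zero = begin
    χ (zeros (suc n))                        ≡⟨ cong χ (sym (⊻-self (zeros (suc n)))) ⟩
    χ (zeros (suc n) ⊻ zeros (suc n))        ≡⟨ lin _ _ ⟩
    χ (zeros (suc n)) xor χ (zeros (suc n))  ≡⟨ xor-same (χ (zeros (suc n))) ⟩
    false                                    ∎
  head : ∀ a → χ (a ∷ zeros n) ≡ χ (unit fzero) ∧ a
  head true  = sym (∧-identityʳ (χ (unit fzero)))
  head false = trans χ-zero (sym (∧-zeroʳ (χ (unit fzero))))

-- Counting.  𝔽₂ⁿ has 2ⁿ elements, and the pigeonhole principle on Fin transfers to 𝔽₂ⁿ.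

Fin↔Bits : ∀ n → Fin (2 ^ n) ↔ Bits n
Fin↔Bits n = ↔-trans (Fin[m^n]↔Fin[m]^n 2 n) (↔-trans (lift↔ n Finₚ.2↔Bool) (↔Vec n))

enumerate : ∀ {n} → Fin (2 ^ n) → Bits n
enumerate {n} = Inverse.to (Fin↔Bits n)

index : ∀ {n} → Bits n → Fin (2 ^ n)
index {n} = Inverse.from (Fin↔Bits n)

enumerate-injective : ∀ {n} → Injective _≡_ _≡_ (enumerate {n})
enumerate-injective {n} = Injection.injective (↔⇒↣ (Fin↔Bits n))

index-injective : ∀ {n} → Injective _≡_ _≡_ (index {n})
index-injective {n} = Injection.injective (↔⇒↣ (↔-sym (Fin↔Bits n)))

transport-injective : ∀ {n k} (f : Bits n → Bits k) → Injective _≡_ _≡_ f →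
                      Injective _≡_ _≡_ (index ∘ f ∘ enumerate)
transport-injective f f-inj eq = enumerate-injective (f-inj (index-injective eq))

-- An injective endomap of Fin N is surjective: a point y outside the image would let
-- the map be squeezed injectively into Fin (N - 1).
fin-injective⇒surjective : ∀ {N} (g : Fin N → Fin N) → Injective _≡_ _≡_ g →
                           ∀ y → ∃[ i ] g i ≡ y
fin-injective⇒surjective {zero}  g g-inj ()
fin-injective⇒surjective {suc N} g g-inj y with Finₚ.any? (λ i → g i Finₚ.≟ y)
... | yes hit  = hit
... | no  miss = ⊥-elim (Finₚ.<⇒notInjective (ℕₚ.n<1+n N) avoid-injective)
  where
  y≢g : ∀ i → y ≢ g i
  y≢g i y≡gi = miss (i , sym y≡gi)
  avoid : Fin (suc N) → Fin N
  avoid i = punchOut (y≢g i)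
  avoid-injective : Injective _≡_ _≡_ avoid
  avoid-injective {i} {j} eq = g-inj (Finₚ.punchOut-injective (y≢g i) (y≢g j) eq)

bits-injective⇒surjective : ∀ {n} (f : Bits n → Bits n) → Injective _≡_ _≡_ f →
                            ∀ y → ∃[ x ] f x ≡ y
bits-injective⇒surjective f f-inj y
  with fin-injective⇒surjective (index ∘ f ∘ enumerate) (transport-injective f f-inj) (index y)
... | i , hit = enumerate i , index-injective hit

no-injection-down : ∀ {m} (f : Bits (suc m) → Bits m) → ¬ Injective _≡_ _≡_ f
no-injection-down {m} f f-inj =
  Finₚ.<⇒notInjective (ℕₚ.^-monoʳ-< 2 (s≤s (s≤s z≤n)) (ℕₚ.n<1+n m)) (transport-injective f f-inj)

search : ∀ {n} (P : Bits n → Bool) → (∃[ v ] P v ≡ false) ⊎ (∀ v → P v ≡ true)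
search {zero} P with P [] in eq
... | false = inj₁ ([] , eq)
... | true  = inj₂ λ { [] → eq }
search {suc n} P with search (P ∘ (false ∷_)) | search (P ∘ (true ∷_))
... | inj₁ (v , p) | _            = inj₁ (false ∷ v , p)
... | inj₂ _       | inj₁ (v , p) = inj₁ (true ∷ v , p)
... | inj₂ f       | inj₂ t       = inj₂ λ { (false ∷ v) → f v ; (true ∷ v) → t v }

-- Hyperplanes.  A subset H of 𝔽₂^(m+1), closed under addition and in bijection with 𝔽₂^m
-- through ψ, is the kernel { v | dot w v = false } of a nonzero w.  Proof: H is proper by
-- counting; the complement of H is a single coset because H and x ⊻ H exhaust the space,
-- so its indicator is additive and therefore a dot product.
module Hyperplane {m : ℕ} (H : Bits (suc m) → Bool)
  (closed : ∀ u v → H u ≡ true → H v ≡ true → H (u ⊻ v) ≡ true)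
  (ψ : Bits m → Bits (suc m)) (ψ-injective : Injective _≡_ _≡_ ψ)
  (ψ-into : ∀ b → H (ψ b) ≡ true) (ψ-onto : ∀ v → H v ≡ true → ∃[ b ] ψ b ≡ v) where

  shift : ∀ u v → H u ≡ true → H (u ⊻ v) ≡ H v
  shift u v hu with H v in hv
  ... | true = closed u v hu hv
  ... | false with H (u ⊻ v) in huv
  ...   | false = refl
  ...   | true  = trans (sym (subst (λ z → H z ≡ true) (⊻-cancelˡ u v) (closed u (u ⊻ v) hu huv))) hv

  shift-ψ : ∀ x b → H (x ⊻ ψ b) ≡ H x
  shift-ψ x b = trans (cong H (⊻-comm x (ψ b))) (shift (ψ b) x (ψ-into b))

  -- H is proper: otherwise ψ⁻¹ would inject 𝔽₂^(m+1) into 𝔽₂^m.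
  proper : ∃[ x ] H x ≡ false
  proper with search H
  ... | inj₁ found = found
  ... | inj₂ full  = ⊥-elim (no-injection-down preimage preimage-injective)
    where
    preimage : Bits (suc m) → Bits m
    preimage v = proj₁ (ψ-onto v (full v))
    preimage-injective : Injective _≡_ _≡_ preimage
    preimage-injective {u} {v} eq =
      trans (sym (proj₂ (ψ-onto u (full u)))) (trans (cong ψ eq) (proj₂ (ψ-onto v (full v))))

  cover : Bits (suc m) → Bits (suc m) → Bits (suc m)
  cover x (false ∷ b) = ψ b
  cover x (true  ∷ b) = x ⊻ ψ b

  cover-disjoint : ∀ x → H x ≡ false → ∀ b b' → ψ b ≢ x ⊻ ψ b'
  cover-disjoint x hx b b' eq with trans (sym (ψ-into b)) (trans (cong H eq) (trans (shift-ψ x b') hx))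
  ... | ()

  cover-injective : ∀ x → H x ≡ false → Injective _≡_ _≡_ (cover x)
  cover-injective x hx {false ∷ b} {false ∷ b'} eq = cong (false ∷_) (ψ-injective eq)
  cover-injective x hx {true  ∷ b} {true  ∷ b'} eq = cong (true ∷_) (ψ-injective (begin
    ψ b                  ≡⟨ sym (⊻-cancelˡ x (ψ b)) ⟩
    x ⊻ (x ⊻ ψ b)        ≡⟨ cong (x ⊻_) eq ⟩
    x ⊻ (x ⊻ ψ b')       ≡⟨ ⊻-cancelˡ x (ψ b') ⟩
    ψ b'                 ∎))
    where open ≡-Reasoning
  cover-injective x hx {false ∷ b} {true  ∷ b'} eq = ⊥-elim (cover-disjoint x hx b b' eq)
  cover-injective x hx {true  ∷ b} {false ∷ b'} eq = ⊥-elim (cover-disjoint x hx b' b (sym eq))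

  -- Two vectors outside H sum into H: being injective, the cover reaches y, and it can
  -- only do so through the translate x ⊻ H.
  outside-sum : ∀ x y → H x ≡ false → H y ≡ false → H (x ⊻ y) ≡ true
  outside-sum x y hx hy with bits-injective⇒surjective (cover x) (cover-injective x hx) y
  ... | true  ∷ b , hit  = subst (λ z → H z ≡ true)
                                 (trans (sym (⊻-cancelˡ x (ψ b))) (cong (x ⊻_) hit)) (ψ-into b)
  ... | false ∷ b , ψb≡y with trans (sym (ψ-into b)) (trans (cong H ψb≡y) hy)
  ...   | ()

  complement-additive : ∀ u v → not (H (u ⊻ v)) ≡ not (H u) xor not (H v)
  complement-additive u v with H u in hu | H v in hv
  ... | true  | _     = cong not (trans (shift u v hu) hv)
  ... | false | true  = cong not (trans (cong H (⊻-comm u v)) (trans (shift v u hv) hu))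
  ... | false | false = cong not (outside-sum u v hu hv)

  is-kernel : Σ (Bits (suc m)) λ w → (∀ v → H v ≡ not (dot w v)) × ∃[ x ] dot w x ≡ true
  is-kernel = w , (λ v → trans (sym (not-involutive (H v))) (cong not (χ≡dot v)))
                , (proj₁ proper , trans (sym (χ≡dot (proj₁ proper))) (cong not (proj₂ proper)))
    where
    χ : Bits (suc m) → Bool
    χ v = not (H v)
    w : Bits (suc m)
    w = tabulate (χ ∘ unit)
    χ≡dot : ∀ v → χ v ≡ dot w v
    χ≡dot = linear⇒dot χ complement-additive

-- Even words.  Doubling Bool → ℤ₄ (false ↦ 0, true ↦ 2) is additive, and identifies 𝔽₂ⁿ
-- with the words of ℤ₄ⁿ all of whose entries are even.

double : Bool → ℤ₄
double false = fzero
double true  = fsuc (fsuc fzero)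

isEven : ℤ₄ → Bool
isEven fzero                      = true
isEven (fsuc fzero)               = false
isEven (fsuc (fsuc fzero))        = true
isEven (fsuc (fsuc (fsuc fzero))) = false

-- The bit b such that x ∈ {2b, 2b + 1}; on even x it inverts double.
halve : ℤ₄ → Bool
halve fzero                      = false
halve (fsuc fzero)               = false
halve (fsuc (fsuc fzero))        = true
halve (fsuc (fsuc (fsuc fzero))) = true

doubles : ∀ {n} → Bits n → Word n
doubles = map double

halves : ∀ {n} → Word n → Bits n
halves = map halve

allEven : ∀ {n} → Word n → Bool
allEven []      = true
allEven (x ∷ v) = isEven x ∧ allEven v

halves-doubles : ∀ {n} (u : Bits n) → halves (doubles u) ≡ u
halves-doubles []          = refl
halves-doubles (false ∷ u) = cong (false ∷_) (halves-doubles u)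
halves-doubles (true  ∷ u) = cong (true ∷_) (halves-doubles u)

allEven-doubles : ∀ {n} (u : Bits n) → allEven (doubles u) ≡ true
allEven-doubles []          = refl
allEven-doubles (false ∷ u) = allEven-doubles u
allEven-doubles (true  ∷ u) = allEven-doubles u

doubles-halves : ∀ {n} (v : Word n) → allEven v ≡ true → doubles (halves v) ≡ v
doubles-halves []                        p = refl
doubles-halves (fzero ∷ v)               p = cong (fzero ∷_) (doubles-halves v p)
doubles-halves (fsuc (fsuc fzero) ∷ v)   p = cong (_ ∷_) (doubles-halves v p)
doubles-halves (fsuc fzero ∷ v)               ()
doubles-halves (fsuc (fsuc (fsuc fzero)) ∷ v) ()

doubles-injective : ∀ {n} → Injective _≡_ _≡_ (doubles {n})
doubles-injective {x = u} {y = v} eq = trans (sym (halves-doubles u)) (trans (cong halves eq) (halves-doubles v))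

doubles-zeros : ∀ n → doubles (zeros n) ≡ 0w
doubles-zeros zero    = refl
doubles-zeros (suc n) = cong (fzero ∷_) (doubles-zeros n)

doubles-⊻ : ∀ {n} (u v : Bits n) → doubles (u ⊻ v) ≡ doubles u ⊕ doubles v
doubles-⊻ []      []      = refl
doubles-⊻ (a ∷ u) (b ∷ v) = cong₂ _∷_ (double-xor a b) (doubles-⊻ u v)
  where
  double-xor : ∀ a b → double (a xor b) ≡ double a +₄ double b
  double-xor false false = refl
  double-xor false true  = refl
  double-xor true  false = refl
  double-xor true  true  = refl

scale-doubles : ∀ {n} (a : ℤ₄) (u : Bits n) → a · doubles u ≡ doubles (map (not (isEven a) ∧_) u)
scale-doubles a []      = refl
scale-doubles a (b ∷ u) = cong₂ _∷_ (scale-double a b) (scale-doubles a u)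
  where
  scale-double : ∀ a b → a *₄ double b ≡ double (not (isEven a) ∧ b)
  scale-double fzero                      false = refl
  scale-double fzero                      true  = refl
  scale-double (fsuc fzero)               false = refl
  scale-double (fsuc fzero)               true  = refl
  scale-double (fsuc (fsuc fzero))        false = refl
  scale-double (fsuc (fsuc fzero))        true  = refl
  scale-double (fsuc (fsuc (fsuc fzero))) false = refl
  scale-double (fsuc (fsuc (fsuc fzero))) true  = refl

idempotent⇒zero : ∀ {n} (x : Word n) → x ≡ x ⊕ x → x ≡ 0w
idempotent⇒zero []          p = refl
idempotent⇒zero (fzero ∷ x) p = cong (fzero ∷_) (idempotent⇒zero x (cong tail p))
idempotent⇒zero (fsuc fzero ∷ x)               ()
idempotent⇒zero (fsuc (fsuc fzero) ∷ x)        ()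
idempotent⇒zero (fsuc (fsuc (fsuc fzero)) ∷ x) ()

order2⇒allEven : ∀ {n} (x : Word n) → x ⊕ x ≡ 0w → allEven x ≡ true
order2⇒allEven []                      p = refl
order2⇒allEven (fzero ∷ x)             p = order2⇒allEven x (cong tail p)
order2⇒allEven (fsuc (fsuc fzero) ∷ x) p = order2⇒allEven x (cong tail p)
order2⇒allEven (fsuc fzero ∷ x)               ()
order2⇒allEven (fsuc (fsuc (fsuc fzero)) ∷ x) ()

-- Kernel codes.  For w ∈ 𝔽₂ⁿ, K(w) = { 2h | dot w h = 0 } is a ℤ₄-code of length n.

kernelMem : ∀ {n} → Bits n → Subset4 n
kernelMem w v = allEven v ∧ not (dot w (halves v))

kernelMem-doubles : ∀ {n} (w h : Bits n) → kernelMem w (doubles h) ≡ not (dot w h)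
kernelMem-doubles w h rewrite allEven-doubles h | halves-doubles h = refl

kernel-view : ∀ {n} (w : Bits n) v → kernelMem w v ≡ true →
              doubles (halves v) ≡ v × dot w (halves v) ≡ false
kernel-view w v p with allEven v in even | dot w (halves v)
kernel-view w v refl | true | false = doubles-halves v even , refl

orthogonal⇒member : ∀ {n} (w h : Bits n) → dot w h ≡ false → kernelMem w (doubles h) ≡ true
orthogonal⇒member w h orth = trans (kernelMem-doubles w h) (cong not orth)

member⇒orthogonal : ∀ {n} (w h : Bits n) → kernelMem w (doubles h) ≡ true → dot w h ≡ false
member⇒orthogonal w h p = trans (sym (not-involutive (dot w h))) (cong not (trans (sym (kernelMem-doubles w h)) p))

-- K(w) is a code: it is the double of the subspace orthogonal to w, and a · 2h is 2h or 0.
Kernel : ∀ {n} → Bits n → Code n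
Kernel {n} w = record { mem = kernelMem w ; zero∈ = zero∈′ ; add∈ = add∈′ ; smul∈ = smul∈′ }
  where
  zero∈′ : kernelMem w 0w ≡ true
  zero∈′ = subst (λ v → kernelMem w v ≡ true) (doubles-zeros n)
             (orthogonal⇒member w (zeros n) (dot-zerosʳ w))
  add∈′ : ∀ u v → kernelMem w u ≡ true → kernelMem w v ≡ true → kernelMem w (u ⊕ v) ≡ true
  add∈′ u v pu pv with kernel-view w u pu | kernel-view w v pv
  ... | u≡ , orth-u | v≡ , orth-v =
    subst (λ x → kernelMem w x ≡ true) (trans (doubles-⊻ (halves u) (halves v)) (cong₂ _⊕_ u≡ v≡))
      (orthogonal⇒member w (halves u ⊻ halves v)
        (trans (dot-⊻ʳ w (halves u) (halves v)) (cong₂ _xor_ orth-u orth-v)))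
  smul∈′ : ∀ a v → kernelMem w v ≡ true → kernelMem w (a · v) ≡ true
  smul∈′ a v pv with kernel-view w v pv
  ... | v≡ , orth =
    subst (λ x → kernelMem w x ≡ true) (trans (sym (scale-doubles a (halves v))) (cong (a ·_) v≡))
      (orthogonal⇒member w (map (not (isEven a) ∧_) (halves v))
        (trans (dot-scaleʳ (not (isEven a)) w (halves v)) (trans (cong (not (isEven a) ∧_) orth) (∧-zeroʳ _))))

toBool : ℤ₂ → Bool
toBool = Inverse.to Finₚ.2↔Bool

fromBool : Bool → ℤ₂
fromBool = Inverse.from Finₚ.2↔Bool

toBits : ∀ {n} → Vec ℤ₂ n → Bits n
toBits = map toBool

fromBits : ∀ {n} → Bits n → Vec ℤ₂ n
fromBits = map fromBool

toBits-fromBits : ∀ {n} (a : Bits n) → toBits (fromBits a) ≡ a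
toBits-fromBits []      = refl
toBits-fromBits (x ∷ a) = cong₂ _∷_ (Inverse.strictlyInverseˡ Finₚ.2↔Bool x) (toBits-fromBits a)

fromBits-toBits : ∀ {n} (b : Vec ℤ₂ n) → fromBits (toBits b) ≡ b
fromBits-toBits []      = refl
fromBits-toBits (x ∷ b) = cong₂ _∷_ (Inverse.strictlyInverseʳ Finₚ.2↔Bool x) (fromBits-toBits b)

toBool-+₂ : ∀ {n} (b b' : Vec ℤ₂ n) → toBits (zipWith _+₂_ b b') ≡ toBits b ⊻ toBits b'
toBool-+₂ []      []        = refl
toBool-+₂ (x ∷ b) (y ∷ b')  = cong₂ _∷_ (pointwise x y) (toBool-+₂ b b')
  where
  pointwise : ∀ x y → toBool (x +₂ y) ≡ toBool x xor toBool y
  pointwise fzero        fzero        = refl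
  pointwise fzero        (fsuc fzero) = refl
  pointwise (fsuc fzero) fzero        = refl
  pointwise (fsuc fzero) (fsuc fzero) = refl

+₂-self : ∀ {n} (b : Vec ℤ₂ n) → zipWith _+₂_ b b ≡ replicate n fzero
+₂-self []                = refl
+₂-self (fzero ∷ b)       = cong (fzero ∷_) (+₂-self b)
+₂-self (fsuc fzero ∷ b)  = cong (fzero ∷_) (+₂-self b)

-- Codes of type 2^m and length m + 1 are kernel codes.  Such a code C is an elementary
-- abelian 2-group, so all its words are even and C = 2H for the set H of halves.  The
-- isomorphism 𝔽₂^m ≅ C makes H a hyperplane, so H = { h | dot w h = 0 } with w ≠ 0.
module TypeTwoCode {m : ℕ} (C : Code (suc m)) (type : HasType C 0 m) where

  Φ : Vec ℤ₂ m → Word (suc m)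
  Φ b = proj₁ type ([] , b)

  Φ-additive : ∀ b b' → Φ (zipWith _+₂_ b b') ≡ Φ b ⊕ Φ b'
  Φ-additive b b' = proj₁ (proj₂ type) [] b [] b'

  Φ-injective : Injective _≡_ _≡_ Φ
  Φ-injective {b} {b'} eq = cong proj₂ (proj₁ (proj₂ (proj₂ type)) ([] , b) ([] , b') eq)

  Φ-onto : ∀ c → c ∈C mem C → ∃[ b ] Φ b ≡ c
  Φ-onto c c∈C with proj₁ (proj₂ (proj₂ (proj₂ type))) c c∈C
  ... | ([] , b) , eq = b , eq

  Φ-into : ∀ b → Φ b ∈C mem C
  Φ-into b = proj₂ (proj₂ (proj₂ (proj₂ type))) ([] , b)

  Φ-zero : Φ (replicate m fzero) ≡ 0w
  Φ-zero = idempotent⇒zero _ (trans (cong Φ (sym (+₂-self (replicate m fzero)))) (Φ-additive _ _))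

  C-even : ∀ c → c ∈C mem C → allEven c ≡ true
  C-even c c∈C with Φ-onto c c∈C
  ... | b , refl = order2⇒allEven (Φ b) (trans (sym (Φ-additive b b)) (trans (cong Φ (+₂-self b)) Φ-zero))

  H : Bits (suc m) → Bool
  H h = mem C (doubles h)

  H-closed : ∀ u v → H u ≡ true → H v ≡ true → H (u ⊻ v) ≡ true
  H-closed u v hu hv = subst (λ x → x ∈C mem C) (sym (doubles-⊻ u v)) (add∈ C _ _ hu hv)

  ψ : Bits m → Bits (suc m)
  ψ a = halves (Φ (fromBits a))

  doubles-ψ : ∀ a → doubles (ψ a) ≡ Φ (fromBits a)
  doubles-ψ a = doubles-halves _ (C-even _ (Φ-into (fromBits a)))

  ψ-injective : Injective _≡_ _≡_ ψ
  ψ-injective {a} {a'} eq = begin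
    a                     ≡⟨ sym (toBits-fromBits a) ⟩
    toBits (fromBits a)   ≡⟨ cong toBits (Φ-injective Φa≡Φa') ⟩
    toBits (fromBits a')  ≡⟨ toBits-fromBits a' ⟩
    a'                    ∎
    where
    open ≡-Reasoning
    Φa≡Φa' : Φ (fromBits a) ≡ Φ (fromBits a')
    Φa≡Φa' = trans (sym (doubles-ψ a)) (trans (cong doubles eq) (doubles-ψ a'))

  ψ-into : ∀ a → H (ψ a) ≡ true
  ψ-into a = subst (λ x → x ∈C mem C) (sym (doubles-ψ a)) (Φ-into (fromBits a))

  ψ-onto : ∀ h → H h ≡ true → ∃[ a ] ψ a ≡ h
  ψ-onto h h∈H with Φ-onto (doubles h) h∈H
  ... | b , Φb≡2h = toBits b , (begin
    halves (Φ (fromBits (toBits b)))  ≡⟨ cong (halves ∘ Φ) (fromBits-toBits b) ⟩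
    halves (Φ b)                      ≡⟨ cong halves Φb≡2h ⟩
    halves (doubles h)                ≡⟨ halves-doubles h ⟩
    h                                 ∎)
    where open ≡-Reasoning

  open Hyperplane H H-closed ψ ψ-injective ψ-into ψ-onto using (is-kernel)

  normal : Bits (suc m)
  normal = proj₁ is-kernel

  normal-nonzero : ∃[ x ] dot normal x ≡ true
  normal-nonzero = proj₂ (proj₂ is-kernel)

  C≡Kernel : ∀ c → mem C c ≡ kernelMem normal c
  C≡Kernel c with allEven c in even
  ... | true  = trans (cong (mem C) (sym (doubles-halves c even))) (proj₁ (proj₂ is-kernel) (halves c))
  ... | false with mem C c in c∈C
  ...   | false = refl
  ...   | true with trans (sym (C-even c c∈C)) even
  ...     | ()

kernel-type : ∀ {m} (p : Bits m) → HasType (Kernel (true ∷ p)) 0 m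
kernel-type {m} p = φ , additive , injective , onto , into
  where
  lift : Bits m → Bits (suc m)
  lift b = dot p b ∷ b
  lift-⊻ : ∀ b b' → lift (b ⊻ b') ≡ lift b ⊻ lift b'
  lift-⊻ b b' = cong (_∷ b ⊻ b') (dot-⊻ʳ p b b')
  φ : Vec ℤ₄ 0 × Vec ℤ₂ m → Word (suc m)
  φ (_ , b) = doubles (lift (toBits b))
  additive : ∀ a b a' b' → φ (zipWith _+₄_ a a' , zipWith _+₂_ b b') ≡ φ (a , b) ⊕ φ (a' , b')
  additive a b a' b' = begin
    doubles (lift (toBits (zipWith _+₂_ b b')))   ≡⟨ cong (doubles ∘ lift) (toBool-+₂ b b') ⟩
    doubles (lift (toBits b ⊻ toBits b'))         ≡⟨ cong doubles (lift-⊻ (toBits b) (toBits b')) ⟩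
    doubles (lift (toBits b) ⊻ lift (toBits b'))  ≡⟨ doubles-⊻ (lift (toBits b)) (lift (toBits b')) ⟩
    φ (a , b) ⊕ φ (a' , b')                       ∎
    where open ≡-Reasoning
  injective : ∀ x y → φ x ≡ φ y → x ≡ y
  injective ([] , b) ([] , b') eq = cong ([] ,_) (begin
    b                     ≡⟨ sym (fromBits-toBits b) ⟩
    fromBits (toBits b)   ≡⟨ cong (fromBits ∘ tail) (doubles-injective eq) ⟩
    fromBits (toBits b')  ≡⟨ fromBits-toBits b' ⟩
    b'                    ∎)
    where open ≡-Reasoning
  -- A member 2 (h₀ ∷ h) of K(1 ∷ p) has h₀ = dot p h, so it is φ of h.
  onto : ∀ v → v ∈C kernelMem (true ∷ p) → ∃[ x ] φ x ≡ v
  onto v v∈K with halves v | kernel-view (true ∷ p) v v∈K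
  ... | h₀ ∷ h | v≡ , orth = ([] , fromBits h) , (begin
    doubles (lift (toBits (fromBits h)))  ≡⟨ cong (doubles ∘ lift) (toBits-fromBits h) ⟩
    doubles (dot p h ∷ h)                 ≡⟨ cong (λ x → doubles (x ∷ h)) (sym (xor-false⇒≡ orth)) ⟩
    doubles (h₀ ∷ h)                      ≡⟨ v≡ ⟩
    v                                     ∎)
    where
    open ≡-Reasoning
    xor-false⇒≡ : ∀ {x y} → x xor y ≡ false → x ≡ y
    xor-false⇒≡ {false} {false} _ = refl
    xor-false⇒≡ {true}  {true}  _ = refl
  into : ∀ x → φ x ∈C kernelMem (true ∷ p)
  into (_ , b) = orthogonal⇒member (true ∷ p) (lift (toBits b)) (xor-same (dot p (toBits b)))

-- Coordinate permutations.  perm σ v is v with its coordinates permuted by σ; an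
-- equivalence of codes without sign changes is exactly perm σ.

perm : ∀ {A : Set} {n} → Permutation′ n → Vec A n → Vec A n
perm σ v = tabulate (λ i → lookup v (σ ⟨$⟩ʳ i))

lookup-perm : ∀ {A : Set} {n} (σ : Permutation′ n) (v : Vec A n) i →
              lookup (perm σ v) i ≡ lookup v (σ ⟨$⟩ʳ i)
lookup-perm σ v i = lookup∘tabulate _ i

perm-∘ : ∀ {A : Set} {n} (τ σ : Permutation′ n) (v : Vec A n) →
         perm (τ ∘ₚ σ) v ≡ perm τ (perm σ v)
perm-∘ τ σ v = tabulate-cong λ i → sym (lookup-perm σ v (τ ⟨$⟩ʳ i))

perm-inverse : ∀ {A : Set} {n} (σ : Permutation′ n) (v : Vec A n) → perm (flip σ) (perm σ v) ≡ v
perm-inverse σ v = ≡-by-lookup _ v λ i →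
  trans (lookup-perm (flip σ) (perm σ v) i) (trans (lookup-perm σ v _) (cong (lookup v) (inverseʳ σ)))

perm-injective : ∀ {A : Set} {n} (σ : Permutation′ n) → Injective _≡_ _≡_ (perm {A} σ)
perm-injective σ {u} {v} eq = trans (sym (perm-inverse σ u)) (trans (cong (perm (flip σ)) eq) (perm-inverse σ v))

perm-map : ∀ {A B : Set} {n} (σ : Permutation′ n) (f : A → B) (v : Vec A n) →
           perm σ (map f v) ≡ map f (perm σ v)
perm-map σ f v = trans (tabulate-cong λ i → lookup-map (σ ⟨$⟩ʳ i) f v) (tabulate-∘ f _)

-- Sign changes fix even words, so on them any equivalence acts as a permutation.
act-doubles : ∀ {n} (σ : Permutation′ n) (s : Fin n → Bool) (h : Bits n) →
              act σ s (doubles h) ≡ doubles (perm σ h)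
act-doubles σ s h =
  trans (tabulate-cong λ i → unsigned (s i) (lookup h (σ ⟨$⟩ʳ i)) (lookup-map (σ ⟨$⟩ʳ i) double h))
        (perm-map σ double h)
  where
  unsigned : ∀ b x {y} → y ≡ double x → signed b y ≡ y
  unsigned true  false refl = refl
  unsigned true  true  refl = refl
  unsigned false x     _    = refl

wt-perm : ∀ {n} (σ : Permutation′ n) (w : Bits n) → wt (perm σ w) ≡ wt w
wt-perm σ w = trans (NatSum.sum-cong-≗ λ i → cong bitValue (lookup-perm σ w i))
                    (sym (NatSum.sum-permute (λ i → bitValue (lookup w i)) σ))

dot-perm : ∀ {n} (σ : Permutation′ n) (w v : Bits n) → dot (perm σ w) (perm σ v) ≡ dot w v
dot-perm σ w v = trans (XorSum.sum-cong-≗ λ i → cong₂ _∧_ (lookup-perm σ w i) (lookup-perm σ v i))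
                       (sym (XorSum.sum-permute (λ i → lookup w i ∧ lookup v i) σ))

_≈ₚ_ : ∀ {n} → Bits n → Bits n → Set
w ≈ₚ w' = Σ (Permutation′ _) λ σ → perm σ w ≡ w'

≈ₚ-sym : ∀ {n} {u v : Bits n} → u ≈ₚ v → v ≈ₚ u
≈ₚ-sym {u = u} (σ , refl) = flip σ , perm-inverse σ u

≈ₚ-trans : ∀ {n} {u v w : Bits n} → u ≈ₚ v → v ≈ₚ w → u ≈ₚ w
≈ₚ-trans {u = u} (σ , refl) (τ , refl) = τ ∘ₚ σ , perm-∘ τ σ u

-- Weights.  Every vector is a permutation of the canonical vector 1^k 0^(n-k) of its
-- weight k, so vectors of equal weight are permutations of each other.

wt-≤ : ∀ {n} (w : Bits n) → wt w ≤ n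
wt-≤ []          = z≤n
wt-≤ (false ∷ w) = ℕₚ.m≤n⇒m≤1+n (wt-≤ w)
wt-≤ (true  ∷ w) = s≤s (wt-≤ w)

canonical : ∀ n → ℕ → Bits n
canonical zero    k       = []
canonical (suc n) zero    = false ∷ canonical n zero
canonical (suc n) (suc k) = true ∷ canonical n k

wt-canonical : ∀ n k → k ≤ n → wt (canonical n k) ≡ k
wt-canonical zero    zero    z≤n     = refl
wt-canonical (suc n) zero    z≤n     = wt-canonical n zero z≤n
wt-canonical (suc n) (suc k) (s≤s p) = cong suc (wt-canonical n k p)

weight-zero⇒orthogonal : ∀ {n} (w : Bits n) → wt w ≡ 0 → ∀ x → dot w x ≡ false
weight-zero⇒orthogonal []          _  []      = refl
weight-zero⇒orthogonal (false ∷ w) w0 (b ∷ x) = weight-zero⇒orthogonal w w0 x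

wt-zeros : ∀ n → wt (zeros n) ≡ 0
wt-zeros zero    = refl
wt-zeros (suc n) = wt-zeros n

wt-unit : ∀ {n} (i : Fin n) → wt (unit i) ≡ 1
wt-unit {suc n} fzero    = cong suc (wt-zeros n)
wt-unit         (fsuc i) = wt-unit i

lookup-canonical : ∀ {n} k (i : Fin n) → lookup (canonical n k) i ≡ (toℕ i <ᵇ k)
lookup-canonical zero    fzero    = refl
lookup-canonical zero    (fsuc i) = lookup-canonical zero i
lookup-canonical (suc k) fzero    = refl
lookup-canonical (suc k) (fsuc i) = lookup-canonical k i

<ᵇ-irrefl : ∀ k → (k <ᵇ k) ≡ false
<ᵇ-irrefl zero    = refl
<ᵇ-irrefl (suc k) = <ᵇ-irrefl k

<ᵇ-suc : ∀ k → (k <ᵇ suc k) ≡ true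
<ᵇ-suc zero    = refl
<ᵇ-suc (suc k) = <ᵇ-suc k

<ᵇ-suc-≢ : ∀ {x k} → x ≢ k → (x <ᵇ suc k) ≡ (x <ᵇ k)
<ᵇ-suc-≢ {zero}  {zero}  x≢k = ⊥-elim (x≢k refl)
<ᵇ-suc-≢ {zero}  {suc k} x≢k = refl
<ᵇ-suc-≢ {suc x} {zero}  x≢k = refl
<ᵇ-suc-≢ {suc x} {suc k} x≢k = <ᵇ-suc-≢ (x≢k ∘ cong suc)

transpose₀ : ∀ {n} → Fin n → Fin (suc n) → Fin (suc n)
transpose₀ t fzero = fsuc t
transpose₀ t (fsuc k) with k Finₚ.≟ t
... | yes _ = fzero
... | no  _ = fsuc k

transpose₀-involutive : ∀ {n} (t : Fin n) i → transpose₀ t (transpose₀ t i) ≡ i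
transpose₀-involutive t fzero with t Finₚ.≟ t
... | yes _   = refl
... | no  t≢t = ⊥-elim (t≢t refl)
transpose₀-involutive t (fsuc k) with k Finₚ.≟ t
... | yes refl = refl
... | no  k≢t with k Finₚ.≟ t
...   | yes k≡t = ⊥-elim (k≢t k≡t)
...   | no  _   = refl

swap₀ : ∀ {n} → Fin n → Permutation′ (suc n)
swap₀ t = permutation (transpose₀ t) (transpose₀ t) (transpose₀-involutive t) (transpose₀-involutive t)

move-zero : ∀ {n k} → k < n → (false ∷ canonical n (suc k)) ≈ₚ canonical (suc n) (suc k)
move-zero {n} {k} k<n = swap₀ t , ≡-by-lookup _ _ λ i →
  trans (lookup-perm (swap₀ t) (false ∷ canonical n (suc k)) i) (at i)
  where
  t : Fin n
  t = fromℕ< k<n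
  toℕ-t : toℕ t ≡ k
  toℕ-t = Finₚ.toℕ-fromℕ< k<n
  at : ∀ i → lookup (false ∷ canonical n (suc k)) (transpose₀ t i) ≡ lookup (canonical (suc n) (suc k)) i
  at fzero = trans (lookup-canonical (suc k) t) (trans (cong (_<ᵇ suc k) toℕ-t) (<ᵇ-suc k))
  at (fsuc j) with j Finₚ.≟ t
  ... | yes refl = sym (trans (lookup-canonical k t) (trans (cong (_<ᵇ k) toℕ-t) (<ᵇ-irrefl k)))
  ... | no  j≢t  = trans (lookup-canonical (suc k) j)
                     (trans (<ᵇ-suc-≢ (λ e → j≢t (Finₚ.toℕ-injective (trans e (sym toℕ-t)))))
                            (sym (lookup-canonical k j)))

-- Sorting: insert the head of w into the sorted tail, moving a 0 behind the ones.
sorted : ∀ {n} (w : Bits n) → w ≈ₚ canonical n (wt w)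
sorted []          = Perm.id , refl
sorted (true ∷ w)  with sorted w
... | π , eq = lift₀ π , cong (true ∷_) eq
sorted (false ∷ w) with wt w | wt-≤ w | sorted w
... | zero  | _   | π , eq = lift₀ π , cong (false ∷_) eq
... | suc k | k<n | π , eq = ≈ₚ-trans {u = false ∷ w} (lift₀ π , cong (false ∷_) eq) (move-zero k<n)

same-weight⇒≈ₚ : ∀ {n} (w w' : Bits n) → wt w ≡ wt w' → w ≈ₚ w'
same-weight⇒≈ₚ {n} w w' eq =
  ≈ₚ-trans {u = w} (sorted w) (subst (λ k → canonical n k ≈ₚ w') (sym eq) (≈ₚ-sym {u = w'} (sorted w')))

-- Equivalence of kernel codes.  K(w) and K(w') are equivalent exactly when w' is a
-- permutation of w, i.e. when wt w = wt w'.

EquivS-cong : ∀ {n} {C C' D D' : Subset4 n} → (∀ v → C v ≡ C' v) → (∀ v → D v ≡ D' v) →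
              EquivS C' D' → EquivS C D
EquivS-cong C≗C' D≗D' (σ , s , fwd , bwd) =
  σ , s , (λ c c∈C → trans (D≗D' _) (fwd c (trans (sym (C≗C' c)) c∈C)))
        , λ d d∈D → let (c , c∈C' , act≡d) = bwd d (trans (sym (D≗D' d)) d∈D)
                    in c , trans (C≗C' c) c∈C' , act≡d

kernel-perm : ∀ {n} (σ : Permutation′ n) (w : Bits n) c →
              kernelMem w c ≡ true → kernelMem (perm σ w) (perm σ c) ≡ true
kernel-perm σ w c c∈K with kernel-view w c c∈K
... | c≡ , orth = begin
  kernelMem (perm σ w) (perm σ c)                     ≡⟨ cong (kernelMem (perm σ w) ∘ perm σ) (sym c≡) ⟩
  kernelMem (perm σ w) (perm σ (doubles (halves c)))  ≡⟨ cong (kernelMem (perm σ w)) (perm-map σ double (halves c)) ⟩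
  kernelMem (perm σ w) (doubles (perm σ (halves c)))  ≡⟨ kernelMem-doubles (perm σ w) (perm σ (halves c)) ⟩
  not (dot (perm σ w) (perm σ (halves c)))            ≡⟨ cong not (trans (dot-perm σ w (halves c)) orth) ⟩
  true                                                ∎
  where open ≡-Reasoning

≈ₚ⇒kernel-equivalent : ∀ {n} {w w' : Bits n} → w ≈ₚ w' → EquivS (kernelMem w) (kernelMem w')
≈ₚ⇒kernel-equivalent {w = w} (σ , refl) =
  σ , (λ _ → false) , kernel-perm σ w
    , λ d d∈K → perm (flip σ) d
              , subst (λ x → kernelMem x (perm (flip σ) d) ≡ true) (perm-inverse σ w)
                      (kernel-perm (flip σ) (perm σ w) d d∈K)
              , perm-inverse (flip σ) d

false⇔false⇒≡ : ∀ {a b : Bool} → (a ≡ false → b ≡ false) → (b ≡ false → a ≡ false) → a ≡ b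
false⇔false⇒≡ {false} {false} _ _ = refl
false⇔false⇒≡ {false} {true}  f _ = sym (f refl)
false⇔false⇒≡ {true}  {false} _ g = g refl
false⇔false⇒≡ {true}  {true}  _ _ = refl

-- An equivalence (σ , s) of K(w) with K(w') acts on even words as σ, so 2h ∈ K(w) iff
-- 2 (perm σ h) ∈ K(w'); hence dot w h = dot w' (perm σ h) for all h, and perm σ w = w'.
kernel-equivalent⇒≈ₚ : ∀ {n} (w w' : Bits n) → EquivS (kernelMem w) (kernelMem w') → w ≈ₚ w'
kernel-equivalent⇒≈ₚ w w' (σ , s , fwd , bwd) = σ , dot-separates (perm σ w) w' λ v → begin
  dot (perm σ w) v                               ≡⟨ cong (dot (perm σ w)) (sym (perm-inverse (flip σ) v)) ⟩
  dot (perm σ w) (perm σ (perm (flip σ) v))      ≡⟨ dot-perm σ w (perm (flip σ) v) ⟩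
  dot w (perm (flip σ) v)                        ≡⟨ form-preserved (perm (flip σ) v) ⟩
  dot w' (perm σ (perm (flip σ) v))              ≡⟨ cong (dot w') (perm-inverse (flip σ) v) ⟩
  dot w' v                                       ∎
  where
  open ≡-Reasoning
  forward : ∀ h → dot w h ≡ false → dot w' (perm σ h) ≡ false
  forward h orth = member⇒orthogonal w' (perm σ h)
    (subst (λ x → kernelMem w' x ≡ true) (act-doubles σ s h) (fwd (doubles h) (orthogonal⇒member w h orth)))
  backward : ∀ h → dot w' (perm σ h) ≡ false → dot w h ≡ false
  backward h orth with bwd (doubles (perm σ h)) (orthogonal⇒member w' (perm σ h) orth)
  ... | c , c∈K , act≡ with kernel-view w c c∈K
  ...   | c≡ , orth-c = subst (λ x → dot w x ≡ false) halves-c≡h orth-c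
    where
    halves-c≡h : halves c ≡ h
    halves-c≡h = perm-injective σ (doubles-injective (begin
      doubles (perm σ (halves c))   ≡⟨ sym (act-doubles σ s (halves c)) ⟩
      act σ s (doubles (halves c))  ≡⟨ cong (act σ s) c≡ ⟩
      act σ s c                     ≡⟨ act≡ ⟩
      doubles (perm σ h)            ∎))
  form-preserved : ∀ h → dot w h ≡ dot w' (perm σ h)
  form-preserved h = false⇔false⇒≡ (forward h) (backward h)

kernel-equivalent⇒same-weight : ∀ {n} (w w' : Bits n) → EquivS (kernelMem w) (kernelMem w') → wt w ≡ wt w'
kernel-equivalent⇒same-weight w w' equiv with kernel-equivalent⇒≈ₚ w w' equiv
... | σ , refl = sym (wt-perm σ w)

-- Trivial extensions.  A code in which every coordinate carries the entry 2 in some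
-- codeword is not equivalent to a trivial extension; K(w) has this property once w has
-- two nonzero entries.  In weight one, K(0 ⋯ 0 1) is itself a trivial extension.

isZero : ℤ₄ → Bool
isZero fzero    = true
isZero (fsuc _) = false

-- The trivial extension as a conjunction (the test for 0 used by trivExt is not exported).
trivExt-unfold : ∀ {k} (C' : Subset4 k) (v : Word (suc k)) → trivExt C' v ≡ isZero (last v) ∧ C' (init v)
trivExt-unfold C' v with last v
... | fzero  = refl
... | fsuc _ = refl

last-lookup : ∀ {A : Set} {k} (v : Vec A (suc k)) → last v ≡ lookup v (fromℕ k)
last-lookup (x ∷ [])     = refl
last-lookup (x ∷ y ∷ ys) = last-lookup (y ∷ ys)

trivExt-last : ∀ {k} (C' : Subset4 k) (v : Word (suc k)) → trivExt C' v ≡ true → last v ≡ fzero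
trivExt-last C' v v∈T with last v | v∈T
... | fzero | _ = refl

last-act-doubles : ∀ {k} (σ : Permutation′ (suc k)) s (h : Bits (suc k)) →
                   last (act σ s (doubles h)) ≡ double (lookup h (σ ⟨$⟩ʳ fromℕ k))
last-act-doubles {k} σ s h = begin
  last (act σ s (doubles h))              ≡⟨ last-lookup (act σ s (doubles h)) ⟩
  lookup (act σ s (doubles h)) (fromℕ k)  ≡⟨ cong (λ x → lookup x (fromℕ k)) (act-doubles σ s h) ⟩
  lookup (doubles (perm σ h)) (fromℕ k)   ≡⟨ lookup-map (fromℕ k) double (perm σ h) ⟩
  double (lookup (perm σ h) (fromℕ k))    ≡⟨ cong double (lookup-perm σ h (fromℕ k)) ⟩
  double (lookup h (σ ⟨$⟩ʳ fromℕ k))      ∎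
  where open ≡-Reasoning

-- If every coordinate carries 2 in some codeword 2h, an equivalence σ would put a 2 into
-- the last coordinate of a trivially extended word.
full-support⇒nontrivial : ∀ {k} (C : Subset4 (suc k)) →
  (∀ a → ∃[ h ] (C (doubles h) ≡ true × lookup h a ≡ true)) → ∀ C' → ¬ EquivS C (trivExt C')
full-support⇒nontrivial {k} C full C' (σ , s , fwd , _) with full (σ ⟨$⟩ʳ fromℕ k)
... | h , h∈C , hₐ = two≢zero (begin
  double true                            ≡⟨ cong double (sym hₐ) ⟩
  double (lookup h (σ ⟨$⟩ʳ fromℕ k))     ≡⟨ sym (last-act-doubles σ s h) ⟩
  last (act σ s (doubles h))             ≡⟨ trivExt-last C' _ (fwd (doubles h) h∈C) ⟩
  fzero                                  ∎)
  where
  open ≡-Reasoning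
  two≢zero : double true ≢ fzero
  two≢zero ()

kernel-full-support : ∀ {k} (q : Bits k) a →
                      ∃[ h ] (kernelMem (true ∷ true ∷ q) (doubles h) ≡ true × lookup h a ≡ true)
kernel-full-support {k} q a =
  witness a , orthogonal⇒member (true ∷ true ∷ q) (witness a) (orthogonal a) , covers a
  where
  -- 1 1 0 ⋯ 0 covers the first two coordinates, and q_t 0 e_t covers coordinate t + 2.
  witness : Fin (suc (suc k)) → Bits (suc (suc k))
  witness (fsuc (fsuc t)) = lookup q t ∷ false ∷ unit t
  witness _               = true ∷ true ∷ zeros k
  orthogonal : ∀ a → dot (true ∷ true ∷ q) (witness a) ≡ false
  orthogonal fzero           = cong (λ x → true xor (true xor x)) (dot-zerosʳ q)
  orthogonal (fsuc fzero)    = cong (λ x → true xor (true xor x)) (dot-zerosʳ q)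
  orthogonal (fsuc (fsuc t)) = trans (cong (lookup q t xor_) (dot-unitʳ q t)) (xor-same (lookup q t))
  unit-self : ∀ {n} (i : Fin n) → lookup (unit i) i ≡ true
  unit-self fzero    = refl
  unit-self (fsuc i) = unit-self i
  covers : ∀ a → lookup (witness a) a ≡ true
  covers fzero           = refl
  covers (fsuc fzero)    = refl
  covers (fsuc (fsuc t)) = unit-self t

kernelMem-false∷ : ∀ {n} (w : Bits n) x v → kernelMem (false ∷ w) (x ∷ v) ≡ isEven x ∧ kernelMem w v
kernelMem-false∷ w x v = ∧-assoc (isEven x) (allEven v) (not (dot w (halves v)))

∧-swap : ∀ a b c → a ∧ (b ∧ c) ≡ b ∧ (a ∧ c)
∧-swap a b c = trans (sym (∧-assoc a b c)) (trans (cong (_∧ c) (∧-comm a b)) (∧-assoc b a c))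

trivial-extension-unit : ∀ m v → trivExt (kernelMem (zeros m)) v ≡ kernelMem (unit (fromℕ m)) v
trivial-extension-unit zero    (fzero                      ∷ []) = refl
trivial-extension-unit zero    (fsuc fzero                 ∷ []) = refl
trivial-extension-unit zero    (fsuc (fsuc fzero)          ∷ []) = refl
trivial-extension-unit zero    (fsuc (fsuc (fsuc fzero))   ∷ []) = refl
trivial-extension-unit (suc m) (x ∷ y ∷ ys) = begin
  trivExt (kernelMem (zeros (suc m))) (x ∷ y ∷ ys)
    ≡⟨ trivExt-unfold (kernelMem (zeros (suc m))) (x ∷ y ∷ ys) ⟩
  isZero (last (y ∷ ys)) ∧ kernelMem (false ∷ zeros m) (x ∷ init (y ∷ ys))
    ≡⟨ cong (isZero (last (y ∷ ys)) ∧_) (kernelMem-false∷ (zeros m) x (init (y ∷ ys))) ⟩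
  isZero (last (y ∷ ys)) ∧ (isEven x ∧ kernelMem (zeros m) (init (y ∷ ys)))
    ≡⟨ ∧-swap (isZero (last (y ∷ ys))) (isEven x) _ ⟩
  isEven x ∧ (isZero (last (y ∷ ys)) ∧ kernelMem (zeros m) (init (y ∷ ys)))
    ≡⟨ cong (isEven x ∧_) (sym (trivExt-unfold (kernelMem (zeros m)) (y ∷ ys))) ⟩
  isEven x ∧ trivExt (kernelMem (zeros m)) (y ∷ ys)
    ≡⟨ cong (isEven x ∧_) (trivial-extension-unit m (y ∷ ys)) ⟩
  isEven x ∧ kernelMem (unit (fromℕ m)) (y ∷ ys)
    ≡⟨ sym (kernelMem-false∷ (unit (fromℕ m)) x (y ∷ ys)) ⟩
  kernelMem (unit (fromℕ (suc m))) (x ∷ y ∷ ys)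
    ∎
  where open ≡-Reasoning

-- Counting equivalence classes.

representatives⇒N′ : ∀ {m k₁ k₂ c} (R : Fin c → Code (suc m)) →
  (∀ i → Counted (R i) k₁ k₂) → (∀ i j → Equiv (R i) (R j) → i ≡ j) →
  (∀ C → Counted C k₁ k₂ → ∃[ i ] Equiv C (R i)) → N′≡ (suc m) k₁ k₂ c
representatives⇒N′ R counted distinct complete =
  tabulate R , (λ i → subst (λ C → Counted C _ _) (R≡ i) (counted i))
             , (λ i j → subst₂ (λ C D → Equiv C D → i ≡ j) (R≡ i) (R≡ j) (distinct i j))
             , λ C counted-C → let (i , equiv) = complete C counted-C in i , subst (Equiv C) (R≡ i) equiv
  where
  R≡ : ∀ i → R i ≡ lookup (tabulate R) i
  R≡ i = sym (lookup∘tabulate R i)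

normalOf : ∀ m → Fin m → Bits (suc m)
normalOf m j = canonical (suc m) (2 + toℕ j)

wt-normalOf : ∀ m (j : Fin m) → wt (normalOf m j) ≡ 2 + toℕ j
wt-normalOf m j = wt-canonical (suc m) (2 + toℕ j) (s≤s (Finₚ.toℕ<n j))

representative : ∀ m → Fin m → Code (suc m)
representative m j = Kernel (normalOf m j)

-- Each representative has type 2^m and is not a trivial extension (its normal starts with 1 1).
representative-counted : ∀ {m} (j : Fin m) → Counted (representative m j) 0 m
representative-counted {suc m} j =
  kernel-type (canonical (suc m) (suc (toℕ j))) ,
  λ C' → full-support⇒nontrivial (kernelMem (normalOf (suc m) j))
                                  (kernel-full-support (canonical m (toℕ j))) (mem C')

representatives-distinct : ∀ {m} (i j : Fin m) → Equiv (representative m i) (representative m j) → i ≡ j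
representatives-distinct {m} i j equiv = Finₚ.toℕ-injective (ℕₚ.+-cancelˡ-≡ 2 _ _ (begin
  2 + toℕ i          ≡⟨ sym (wt-normalOf m i) ⟩
  wt (normalOf m i)  ≡⟨ kernel-equivalent⇒same-weight (normalOf m i) (normalOf m j) equiv ⟩
  wt (normalOf m j)  ≡⟨ wt-normalOf m j ⟩
  2 + toℕ j          ∎))
  where open ≡-Reasoning

-- A counted code is K(w) with w ≠ 0; weight 1 is excluded as a trivial extension, and
-- weight j + 2 makes it equivalent to the j-th representative.
representatives-complete : ∀ {m} (C : Code (suc m)) → Counted C 0 m → ∃[ j ] Equiv C (representative m j)
representatives-complete {m} C (type , nontrivial) = by-weight (wt normal) refl (wt-≤ normal)
  where
  open TypeTwoCode C type using (normal; normal-nonzero; C≡Kernel)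
  equivalent-to : ∀ {w} → normal ≈ₚ w → EquivS (mem C) (kernelMem w)
  equivalent-to p = EquivS-cong C≡Kernel (λ _ → refl) (≈ₚ⇒kernel-equivalent {w = normal} p)
  by-weight : ∀ k → wt normal ≡ k → k ≤ suc m → ∃[ j ] Equiv C (representative m j)
  by-weight zero w0 _
    with trans (sym (proj₂ normal-nonzero)) (weight-zero⇒orthogonal normal w0 (proj₁ normal-nonzero))
  ... | ()
  by-weight (suc zero) w1 _ = ⊥-elim (nontrivial (Kernel (zeros m))
    (EquivS-cong (λ _ → refl) (trivial-extension-unit m)
      (equivalent-to (same-weight⇒≈ₚ normal (unit (fromℕ m)) (trans w1 (sym (wt-unit (fromℕ m))))))))
  by-weight (suc (suc k)) wk (s≤s k<m) = j , equivalent-to (same-weight⇒≈ₚ normal (normalOf m j) (begin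
    wt normal           ≡⟨ wk ⟩
    2 + k               ≡⟨ cong (2 +_) (sym (Finₚ.toℕ-fromℕ< k<m)) ⟩
    2 + toℕ j           ≡⟨ sym (wt-normalOf m j) ⟩
    wt (normalOf m j)   ∎))
    where
    open ≡-Reasoning
    j : Fin m
    j = fromℕ< k<m

proposition4p5 : (m : ℕ) → N′≡ (suc m) 0 m m
proposition4p5 m = representatives⇒N′ (representative m)
  representative-counted representatives-distinct representatives-complete
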